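{- Let $\mathcal E$ be a category and $\mathcal F\subseteq\mathcal E$ a subcategory with the same objects. For $X\subseteq\mathcal E$ let $\delta_{\mathcal F}(X)$ be the set of all $g\in\mathcal E$ such that there is $h\in X$ with $g\circ h$ defined and in $\mathcal F$, and such that $g\circ f\in X$ for every $f\in\mathcal F$ for which $g\circ f$ is defined. Then the operator $\delta_{\mathcal F}$ (which is monotone and satisfies $\delta_{\mathcal F}(X)\subseteq X$) has a greatest fixed point, and this greatest fixed point equals the domination closure $[\mathcal F]$ of $\mathcal F$ in $\mathcal E$.
   Context: For a set $X$ of morphisms of $\mathcal E$, $\mathcal F$ is dominating in $X$ if (i) $g\circ f\in X$ for all $f\in\mathcal F$, $g\in X$ with $\mathrm{codom}(f)=\mathrm{dom}(g)$, and (ii) for every $g'\in X$ there is $g''\in X$ with $g'\circ g''\in\mathcal F$. The domination closure $[\mathcal F]$ of $\mathcal F$ in $\mathcal E$ is the union of all $X\subseteq\mathcal E$ in which $\mathcal F$ is dominating. -}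

module Defs where

open import Level using (Level; _⊔_; suc)
open import Data.Product using (Σ; Σ-syntax; ∃; ∃-syntax; _×_; _,_)
open import Relation.Binary.PropositionalEquality using (_≡_)

record Category (o h : Level) : Set (suc (o ⊔ h)) where
  infixr 9 _∘_
  field
    Obj       : Set o
    Hom       : Obj → Obj → Set h
    id        : ∀ {A} → Hom A A
    _∘_       : ∀ {A B C} → Hom B C → Hom A B → Hom A C
    identityˡ : ∀ {A B} (f : Hom A B) → id ∘ f ≡ f
    identityʳ : ∀ {A B} (f : Hom A B) → f ∘ id ≡ f
    assoc     : ∀ {A B C D} (f : Hom A B) (g : Hom B C) (k : Hom C D) →
                (k ∘ g) ∘ f ≡ k ∘ (g ∘ f)

module _ {o h : Level} (𝓔 : Category o h) where
  open Category 𝓔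

  MorSet : (ℓ : Level) → Set (o ⊔ h ⊔ suc ℓ)
  MorSet ℓ = ∀ {A B} → Hom A B → Set ℓ

  _⊆_ : ∀ {ℓ₁ ℓ₂} → MorSet ℓ₁ → MorSet ℓ₂ → Set (o ⊔ h ⊔ ℓ₁ ⊔ ℓ₂)
  X ⊆ Y = ∀ {A B} (g : Hom A B) → X g → Y g

  record IsWideSubcategory {p} (𝓕 : MorSet p) : Set (o ⊔ h ⊔ p) where
    field
      id-closed : ∀ {A} → 𝓕 (id {A})
      ∘-closed  : ∀ {A B C} (f : Hom A B) (g : Hom B C) → 𝓕 f → 𝓕 g → 𝓕 (g ∘ f)

  δ : ∀ {p ℓ} → MorSet p → MorSet ℓ → MorSet (o ⊔ h ⊔ p ⊔ ℓ)
  δ 𝓕 X {B} {C} g =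
    (Σ[ A ∈ Obj ] Σ[ k ∈ Hom A B ] (X k × 𝓕 (g ∘ k)))
    × (∀ {A} (f : Hom A B) → 𝓕 f → X (g ∘ f))

  Dominating : ∀ {p ℓ} → MorSet p → MorSet ℓ → Set (o ⊔ h ⊔ p ⊔ ℓ)
  Dominating 𝓕 X =
    (∀ {A B C} (f : Hom A B) (g : Hom B C) → 𝓕 f → X g → X (g ∘ f))
    × (∀ {B C} (g′ : Hom B C) → X g′ →
         Σ[ A ∈ Obj ] Σ[ g″ ∈ Hom A B ] (X g″ × 𝓕 (g′ ∘ g″)))

  DomClosure : ∀ {p} (ℓ : Level) → MorSet p → MorSet (o ⊔ h ⊔ p ⊔ suc ℓ)
  DomClosure ℓ 𝓕 g = Σ[ X ∈ MorSet ℓ ] (Dominating 𝓕 X × X g)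

module Submission where

-- The whole argument rests on one observation: 𝓕 is dominating in X
-- exactly when X is a post-fixed point of δ_𝓕, i.e. X ⊆ δ_𝓕(X); the two
-- clauses of "dominating" are literally the two components of membership
-- in δ_𝓕(X).  Hence [𝓕] is the union of all post-fixed points of δ_𝓕.
-- The usual Knaster–Tarski reasoning then finishes the proof:
--   * monotonicity of δ_𝓕 is immediate from its definition;
--   * δ_𝓕(X) ⊆ X because 𝓕 contains identities (take f = id);
--   * the union [𝓕] of post-fixed points is again post-fixed, by
--     monotonicity applied to each member of the union;
--   * [𝓕] ⊆ δ_𝓕([𝓕]) combined with deflation gives the fixed point, and
--     every fixed point, being post-fixed, lies in [𝓕].

open import Defs
open import Level using (Level)
open import Data.Product using (_×_; _,_; proj₁; proj₂)
open import Relation.Binary.PropositionalEquality using (subst)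

module _ {o h p : Level} (𝓔 : Category o h) (𝓕 : MorSet 𝓔 p) where
  open Category 𝓔

  δ-monotone : ∀ {ℓ₁ ℓ₂} {X : MorSet 𝓔 ℓ₁} {Y : MorSet 𝓔 ℓ₂} →
    _⊆_ 𝓔 X Y → _⊆_ 𝓔 (δ 𝓔 𝓕 X) (δ 𝓔 𝓕 Y)
  δ-monotone X⊆Y g ((A , k , k∈X , gk∈𝓕) , g𝓕⊆X) =
    (A , k , X⊆Y k k∈X , gk∈𝓕) , λ f f∈𝓕 → X⊆Y _ (g𝓕⊆X f f∈𝓕)

  -- δ_𝓕 is deflationary as soon as 𝓕 contains the identities:
  -- g ∈ δ_𝓕(X) gives g ∘ id ∈ X.
  δ-deflationary : ∀ {ℓ} {X : MorSet 𝓔 ℓ} →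
    (∀ {A} → 𝓕 (id {A})) → _⊆_ 𝓔 (δ 𝓔 𝓕 X) X
  δ-deflationary {X = X} id∈𝓕 g (_ , g𝓕⊆X) =
    subst X (identityʳ g) (g𝓕⊆X id id∈𝓕)

  dominating⇒postfixed : ∀ {ℓ} {X : MorSet 𝓔 ℓ} →
    Dominating 𝓔 𝓕 X → _⊆_ 𝓔 X (δ 𝓔 𝓕 X)
  dominating⇒postfixed (X∘𝓕⊆X , X-dominated) g g∈X =
    X-dominated g g∈X , λ f f∈𝓕 → X∘𝓕⊆X f g f∈𝓕 g∈X

  postfixed⇒dominating : ∀ {ℓ} {X : MorSet 𝓔 ℓ} →
    _⊆_ 𝓔 X (δ 𝓔 𝓕 X) → Dominating 𝓔 𝓕 X
  postfixed⇒dominating X⊆δX =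
    (λ f g f∈𝓕 g∈X → proj₂ (X⊆δX g g∈X) f f∈𝓕) ,
    (λ g g∈X → proj₁ (X⊆δX g g∈X))

  postfixed⊆DomClosure : ∀ {ℓ} {X : MorSet 𝓔 ℓ} →
    _⊆_ 𝓔 X (δ 𝓔 𝓕 X) → _⊆_ 𝓔 X (DomClosure 𝓔 ℓ 𝓕)
  postfixed⊆DomClosure {X = X} X⊆δX g g∈X =
    X , postfixed⇒dominating X⊆δX , g∈X

  -- [𝓕] is itself a post-fixed point: a witness X ∋ g is post-fixed, and
  -- δ_𝓕(X) ⊆ δ_𝓕([𝓕]) by monotonicity, since X ⊆ [𝓕].
  DomClosure-postfixed : ∀ ℓ →
    _⊆_ 𝓔 (DomClosure 𝓔 ℓ 𝓕) (δ 𝓔 𝓕 (DomClosure 𝓔 ℓ 𝓕))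
  DomClosure-postfixed ℓ g (X , 𝓕-dominates-X , g∈X) =
    δ-monotone {Y = DomClosure 𝓔 ℓ 𝓕} (postfixed⊆DomClosure X⊆δX) g (X⊆δX g g∈X)
    where
    X⊆δX : _⊆_ 𝓔 X (δ 𝓔 𝓕 X)
    X⊆δX = dominating⇒postfixed 𝓕-dominates-X

proposition4p4 : ∀ {o h p ℓ : Level} (𝓔 : Category o h) (𝓕 : MorSet 𝓔 p) →
    IsWideSubcategory 𝓔 𝓕 →
    (∀ (X Y : MorSet 𝓔 ℓ) →
    _⊆_ 𝓔 X Y → _⊆_ 𝓔 (δ 𝓔 𝓕 X) (δ 𝓔 𝓕 Y))
    × (∀ (X : MorSet 𝓔 ℓ) → _⊆_ 𝓔 (δ 𝓔 𝓕 X) X)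
    × _⊆_ 𝓔 (δ 𝓔 𝓕 (DomClosure 𝓔 ℓ 𝓕)) (DomClosure 𝓔 ℓ 𝓕)
    × _⊆_ 𝓔 (DomClosure 𝓔 ℓ 𝓕) (δ 𝓔 𝓕 (DomClosure 𝓔 ℓ 𝓕))
    × (∀ (Y : MorSet 𝓔 ℓ) → _⊆_ 𝓔 (δ 𝓔 𝓕 Y) Y → _⊆_ 𝓔 Y (δ 𝓔 𝓕 Y) →
    _⊆_ 𝓔 Y (DomClosure 𝓔 ℓ 𝓕))
proposition4p4 {ℓ = ℓ} 𝓔 𝓕 wide =
    (λ X Y → δ-monotone 𝓔 𝓕 {X = X} {Y = Y}) ,
    (λ X → δ-deflationary 𝓔 𝓕 {X = X} id-closed) ,
    δ-deflationary 𝓔 𝓕 {X = DomClosure 𝓔 ℓ 𝓕} id-closed ,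
    DomClosure-postfixed 𝓔 𝓕 ℓ ,
    (λ Y _ Y⊆δY → postfixed⊆DomClosure 𝓔 𝓕 Y⊆δY)
  where
  open IsWideSubcategory wide using (id-closed)
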